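{- Let $W$ be an $m\times m$ widely-spaced primes matrix. For locations $(i,j)$ and $(r,s)$, if $(W\times W)_{i,j}=(W\times W)_{r,s}$ (ordinary matrix product), then the multiset of products $\{\{W_{i,k}W_{k,j}:k=1,\dots,m\}\}$ equals the multiset $\{\{W_{r,k}W_{k,s}:k=1,\dots,m\}\}$; that is, each inner product of $W\times W$ determines the set of distinct terms appearing in it together with their multiplicities.
   Context: A widely-spaced primes matrix $W=wspm(M)$, built from a real symmetric $m\times m$ matrix $M$ whose diagonal entries are all different from its off-diagonal entries, is defined as follows. Let $M$ have $n$ distinct entries, $n_1$ occurring off the diagonal and $n_2$ on the diagonal ($n_1+n_2=n$). Choose primes $p_1<\dots<p_n$ with $p_1>mk^2$ for some positive integer $k$ and $p_i>m\,p_{i-1}^2$ for $i=2,\dots,n$. $W$ has the same pattern as $M$ (i.e. $W_{i,j}=W_{r,s}$ iff $M_{i,j}=M_{r,s}$), its off-diagonal entries take the values $p_1,\dots,p_{n_1}$ and its diagonal entries the values $p_{n_1+1},\dots,p_n$. -}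

module Defs where

open import Data.Nat using (ℕ; _+_; _*_; _<_)
open import Data.Nat.Primality using (Prime)
open import Data.Fin using (Fin; toℕ; _↑ˡ_; _↑ʳ_)
open import Data.List using (List; map)
open import Data.Nat.ListAction using (sum)
open import Data.List.Base using (allFin)
open import Data.Product using (Σ; ∃; _×_)
open import Relation.Binary.PropositionalEquality using (_≡_; _≢_)

Matrix : ℕ → Set
Matrix m = Fin m → Fin m → ℕ

terms : ∀ {m} → Matrix m → Fin m → Fin m → List ℕ
terms {m} W i j = map (λ k → W i k * W k j) (allFin m)

sq : ∀ {m} → Matrix m → Matrix m
sq W i j = sum (terms W i j)

WidelySpacedPrimes : (m n₁ n₂ : ℕ) → (Fin (n₁ + n₂) → ℕ) → Set
WidelySpacedPrimes m n₁ n₂ p =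
  (∀ a → Prime (p a)) ×
  (Σ ℕ λ k → (0 < k) × (∀ a → toℕ a ≡ 0 → m * (k * k) < p a)) ×
  (∀ a b → toℕ b ≡ toℕ a + 1 → m * (p a * p a) < p b)

-- W is a widely-spaced primes matrix: W = wspm(M) for a symmetric M whose diagonal values
-- differ from its off-diagonal values.  Since W has the same pattern as M, one may take
-- M = W itself: W is symmetric, its off-diagonal entries take exactly the
-- values p_1..p_{n₁}, and its diagonal entries take exactly the values p_{n₁+1}..p_n.
IsWSPM : ∀ {m} → Matrix m → Set
IsWSPM {m} W =
  Σ ℕ λ n₁ → Σ ℕ λ n₂ → Σ (Fin (n₁ + n₂) → ℕ) λ p →
    WidelySpacedPrimes m n₁ n₂ p ×
    (∀ i j → W i j ≡ W j i) ×
    (∀ i j → i ≢ j → ∃ λ (l : Fin n₁) → W i j ≡ p (l ↑ˡ n₂)) ×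
    (∀ (l : Fin n₁) → ∃ λ i → ∃ λ j → (i ≢ j) × (W i j ≡ p (l ↑ˡ n₂))) ×
    (∀ i → ∃ λ (l : Fin n₂) → W i i ≡ p (n₁ ↑ʳ l)) ×
    (∀ (l : Fin n₂) → ∃ λ i → W i i ≡ p (n₁ ↑ʳ l))

-- Every term W i k * W k j is a product p_a p_b of two of the widely-spaced primes, and such
-- products are m-separated: if x < y then m x < y (compare the larger factors first, then the
-- smaller ones).  In a sum of at most m separated numbers the largest term therefore exceeds the
-- sum of all the others, so two such sums can only agree if their largest terms agree; cancelling
-- these and repeating shows that the two lists of terms are equal as multisets.
module Submission where

open import Data.Nat using (ℕ; zero; suc; _+_; _*_; _≤_; _<_; _≤?_; z≤n; z<s; NonZero; >-nonZero)
open import Data.Nat.Properties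
open import Data.Nat.ListAction using (sum)
open import Data.Nat.ListAction.Properties using (sum-↭)
open import Data.Fin as Fin using (Fin; toℕ; fromℕ<; _↑ˡ_; _↑ʳ_)
import Data.Fin.Properties as Fin
open import Data.Fin.Properties using (toℕ-fromℕ<; toℕ-injective; toℕ<n)
open import Data.List using (List; []; _∷_; length; map; allFin)
open import Data.List.Properties using (length-map; length-tabulate)
open import Data.List.Relation.Unary.All as All using (All; []; _∷_)
open import Data.List.Relation.Unary.All.Properties using (map⁺; tabulate⁺)
open import Data.List.Relation.Binary.Permutation.Propositional using (_↭_; prep; swap; ↭-refl; ↭-sym; ↭-trans)
open import Data.List.Relation.Binary.Permutation.Propositional.Properties using (All-resp-↭; ↭-length)
open import Data.Product using (Σ; ∃; _×_; _,_)
open import Data.Sum using (inj₁; inj₂)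
open import Data.Empty using (⊥-elim)
open import Relation.Nullary using (¬_; yes; no)
open import Relation.Binary using (Rel; Transitive; tri<; tri≈; tri>)
open import Relation.Binary.PropositionalEquality using (_≡_; refl; sym; trans; cong; cong₂; subst; subst₂)
open import Level using (0ℓ)

open import Defs

extract-max : (x : ℕ) (xs : List ℕ) →
              Σ ℕ λ y → Σ (List ℕ) λ rest → (x ∷ xs ↭ y ∷ rest) × All (_≤ y) rest
extract-max x [] = x , [] , ↭-refl , []
extract-max x (x′ ∷ xs) with extract-max x′ xs
... | y , rest , x′∷xs↭y∷rest , rest≤y with x ≤? y
...   | yes x≤y = y , x ∷ rest , ↭-trans (prep x x′∷xs↭y∷rest) (swap x y ↭-refl) , x≤y ∷ rest≤y
...   | no x≰y  = x , y ∷ rest , prep x x′∷xs↭y∷rest , y≤x ∷ All.map (λ z≤y → ≤-trans z≤y y≤x) rest≤y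
  where y≤x = <⇒≤ (≰⇒> x≰y)

sum≤length*bound : ∀ {y} xs → All (_≤ y) xs → sum xs ≤ length xs * y
sum≤length*bound []       []            = z≤n
sum≤length*bound (x ∷ xs) (x≤y ∷ xs≤y) = +-mono-≤ x≤y (sum≤length*bound xs xs≤y)

Separated : ℕ → (ℕ → Set) → Set
Separated m P = ∀ {x y} → P x → P y → x < y → m * x < y

module _ {m : ℕ} {P : ℕ → Set} (separated : Separated m P) where

  private
    max+sum< : ∀ {a b} as bs → length as < m → All (_≤ a) as →
               P a → P b → a < b → a + sum as < b + sum bs
    max+sum< {a} {b} as bs |as|<m as≤a Pa Pb a<b = begin-strict
      a + sum as            ≤⟨ +-monoʳ-≤ a (sum≤length*bound as as≤a) ⟩
      suc (length as) * a   ≤⟨ *-monoˡ-≤ a |as|<m ⟩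
      m * a                 <⟨ separated Pa Pb a<b ⟩
      b                     ≤⟨ m≤m+n b (sum bs) ⟩
      b + sum bs            ∎
      where open ≤-Reasoning

  separated-sum≡⇒↭ : ∀ n xs ys → length xs ≡ n → length ys ≡ n → n ≤ m →
                     All P xs → All P ys → sum xs ≡ sum ys → xs ↭ ys

  private
    max∷-sum≡⇒↭ : ∀ n {a b} as bs → length as ≡ n → length bs ≡ n → n < m →
                  All (_≤ a) as → All (_≤ b) bs → All P (a ∷ as) → All P (b ∷ bs) →
                  a + sum as ≡ b + sum bs → a ∷ as ↭ b ∷ bs
    max∷-sum≡⇒↭ n {a} {b} as bs |as| |bs| n<m as≤a bs≤b (Pa ∷ Pas) (Pb ∷ Pbs) Σ≡ with <-cmp a b
    ... | tri< a<b _ _ =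
      ⊥-elim (<-irrefl Σ≡ (max+sum< as bs (subst (_< m) (sym |as|) n<m) as≤a Pa Pb a<b))
    ... | tri> _ _ b<a =
      ⊥-elim (<-irrefl (sym Σ≡) (max+sum< bs as (subst (_< m) (sym |bs|) n<m) bs≤b Pb Pa b<a))
    ... | tri≈ _ refl _ =
      prep a (separated-sum≡⇒↭ n as bs |as| |bs| (<⇒≤ n<m) Pas Pbs (+-cancelˡ-≡ a _ _ Σ≡))

  separated-sum≡⇒↭ zero    []       []       _   _   _   _   _   _ = ↭-refl
  separated-sum≡⇒↭ (suc n) (x ∷ xs) (y ∷ ys) |x| |y| n<m Pxs Pys Σ≡
    with extract-max x xs | extract-max y ys
  ... | a , as , xs↭ , as≤a | b , bs , ys↭ , bs≤b =
    ↭-trans xs↭ (↭-trans (max∷-sum≡⇒↭ n as bs (length-rest xs↭ |x|) (length-rest ys↭ |y|) n<m as≤a bs≤b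
                                        (All-resp-↭ xs↭ Pxs) (All-resp-↭ ys↭ Pys)
                                        (trans (sym (sum-↭ xs↭)) (trans Σ≡ (sum-↭ ys↭))))
                         (↭-sym ys↭))
    where
    length-rest : ∀ {u us v vs} → u ∷ us ↭ v ∷ vs → length (u ∷ us) ≡ suc n → length vs ≡ n
    length-rest u∷us↭ |u∷us| = suc-injective (trans (sym (↭-length u∷us↭)) |u∷us|)

successor⇒< : ∀ {N ℓ} {R : Rel (Fin N) ℓ} → Transitive R →
              (∀ a b → toℕ b ≡ toℕ a + 1 → R a b) → ∀ {a b} → a Fin.< b → R a b
successor⇒< {N} {R = R} R-trans R-step {a} {b} a<b = from-gap _ a b (sym (m∸n+n≡m a<b))
  where
  R-step′ : ∀ a b → toℕ b ≡ suc (toℕ a) → R a b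
  R-step′ a b b≡ = R-step a b (trans b≡ (+-comm 1 (toℕ a)))

  from-gap : ∀ d a b → toℕ b ≡ d + suc (toℕ a) → R a b
  from-gap zero    a b b≡ = R-step′ a b b≡
  from-gap (suc d) a b b≡ = R-trans (from-gap d a b′ (toℕ-fromℕ< b′<N))
                                    (R-step′ b′ b (trans b≡ (cong suc (sym (toℕ-fromℕ< b′<N)))))
    where
    b′<N : d + suc (toℕ a) < N
    b′<N = <-trans (n<1+n _) (subst (_< N) b≡ (toℕ<n b))
    b′ = fromℕ< b′<N

x≤m*[x*x] : ∀ m .{{_ : NonZero m}} {x} → 0 < x → x ≤ m * (x * x)
x≤m*[x*x] m {x} 0<x = ≤-trans (m≤m*n x x {{>-nonZero 0<x}}) (m≤n*m (x * x) m)

m*n<o⇒o≮n : ∀ m .{{_ : NonZero m}} {n o} → m * n < o → ¬ o < n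
m*n<o⇒o≮n m {n} m*n<o o<n = <-asym o<n (≤-<-trans (m≤n*m n m) m*n<o)

module WidelySpaced {m N : ℕ} .{{_ : NonZero m}} (p : Fin N → ℕ)
  (p₀-positive : ∀ a → toℕ a ≡ 0 → 0 < p a)
  (spaced : ∀ a b → toℕ b ≡ toℕ a + 1 → m * (p a * p a) < p b) where

  _≪_ : Rel (Fin N) 0ℓ
  a ≪ b = m * (p a * p a) < p b

  ≪-trans : Transitive _≪_
  ≪-trans a≪b b≪c = <-trans a≪b (≤-<-trans (x≤m*[x*x] m (≤-<-trans z≤n a≪b)) b≪c)

  <⇒≪ : ∀ {a b} → a Fin.< b → a ≪ b
  <⇒≪ = successor⇒< ≪-trans spaced

  p-positive : ∀ a → 0 < p a
  p-positive a with toℕ a in a≡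
  ... | zero  = p₀-positive a a≡
  ... | suc _ = ≤-<-trans z≤n (<⇒≪ {a₀} {a} (subst₂ _<_ (sym (toℕ-fromℕ< 0<N)) (sym a≡) z<s))
    where
    0<N = ≤-<-trans z≤n (toℕ<n a)
    a₀ = fromℕ< 0<N

  p-nonZero : ∀ a → NonZero (p a)
  p-nonZero a = >-nonZero (p-positive a)

  p-< : ∀ {a b} → a Fin.< b → p a < p b
  p-< {a} a<b = ≤-<-trans (x≤m*[x*x] m (p-positive a)) (<⇒≪ a<b)

  m*p-< : ∀ {a b} → a Fin.< b → m * p a < p b
  m*p-< {a} a<b = ≤-<-trans (*-monoʳ-≤ m (m≤m*n (p a) (p a) {{p-nonZero a}})) (<⇒≪ a<b)

  p-mono : ∀ {a b} → a Fin.≤ b → p a ≤ p b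
  p-mono a≤b with m≤n⇒m<n∨m≡n a≤b
  ... | inj₁ a<b = <⇒≤ (p-< a<b)
  ... | inj₂ a≡b = ≤-reflexive (cong p (toℕ-injective a≡b))

  Product : ℕ → Set
  Product x = Σ (Fin N) λ a → Σ (Fin N) λ b → a Fin.≤ b × x ≡ p a * p b

  product : ∀ a b → Product (p a * p b)
  product a b with ≤-total (toℕ a) (toℕ b)
  ... | inj₁ a≤b = a , b , a≤b , refl
  ... | inj₂ b≤a = b , a , b≤a , *-comm (p a) (p b)

  larger-max-separated : ∀ {a b c d} → a Fin.≤ b → b Fin.< d → m * (p a * p b) < p c * p d
  larger-max-separated {a} {b} {c} {d} a≤b b<d = begin-strict
    m * (p a * p b)  ≤⟨ *-monoʳ-≤ m (*-monoˡ-≤ (p b) (p-mono a≤b)) ⟩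
    m * (p b * p b)  <⟨ <⇒≪ b<d ⟩
    p d              ≤⟨ m≤n*m (p d) (p c) {{p-nonZero c}} ⟩
    p c * p d        ∎
    where open ≤-Reasoning

  same-max-separated : ∀ {a b c} → a Fin.< c → m * (p a * p b) < p c * p b
  same-max-separated {a} {b} {c} a<c = begin-strict
    m * (p a * p b)  ≡⟨ *-assoc m (p a) (p b) ⟨
    m * p a * p b    <⟨ *-monoˡ-< (p b) {{p-nonZero b}} (m*p-< a<c) ⟩
    p c * p b        ∎
    where open ≤-Reasoning

  products-separated : Separated m Product
  products-separated (a , b , a≤b , refl) (c , d , c≤d , refl) x<y with Fin.<-cmp b d
  ... | tri< b<d _ _ = larger-max-separated a≤b b<d
  ... | tri> _ _ d<b = ⊥-elim (m*n<o⇒o≮n m (larger-max-separated c≤d d<b) x<y)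
  ... | tri≈ _ refl _ with Fin.<-cmp a c
  ...   | tri< a<c _ _ = same-max-separated a<c
  ...   | tri≈ _ refl _ = ⊥-elim (<-irrefl refl x<y)
  ...   | tri> _ _ c<a = ⊥-elim (m*n<o⇒o≮n m (same-max-separated c<a) x<y)

lemma27 : (m : ℕ) (W : Matrix m) → IsWSPM W →
    (i j r s : Fin m) → sq W i j ≡ sq W r s → terms W i j ↭ terms W r s
lemma27 zero W _ ()
lemma27 m@(suc _) W (n₁ , n₂ , p , (_ , (_ , _ , p₀-large) , spaced) , _ , off-diagonal , _ , diagonal , _)
        i j r s sq≡ =
  separated-sum≡⇒↭ products-separated m (terms W i j) (terms W r s)
    (length-terms i j) (length-terms r s) ≤-refl (terms-products i j) (terms-products r s) sq≡
  where
  open WidelySpaced {m} p (λ a a≡0 → ≤-<-trans z≤n (p₀-large a a≡0)) spaced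

  entry : ∀ x y → ∃ λ a → W x y ≡ p a
  entry x y with x Fin.≟ y
  ... | yes refl = let l , Wxx≡ = diagonal x in n₁ ↑ʳ l , Wxx≡
  ... | no x≢y   = let l , Wxy≡ = off-diagonal x y x≢y in l ↑ˡ n₂ , Wxy≡

  length-terms : ∀ x y → length (terms W x y) ≡ m
  length-terms x y = trans (length-map _ (allFin m)) (length-tabulate {n = m} (λ k → k))

  terms-products : ∀ x y → All Product (terms W x y)
  terms-products x y = map⁺ (tabulate⁺ λ k →
    let a , Wxk≡ = entry x k
        b , Wky≡ = entry k y
    in subst Product (sym (cong₂ _*_ Wxk≡ Wky≡)) (product a b))
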